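{- Let $R : X\leftrightarrow\mathcal{P} Y$ and $S : Y\leftrightarrow\mathcal{P} Z$ be outer total multirelations. Then (1) $\alpha(R\ast S) = \alpha(R)\,\alpha(S)$; (2) $\delta_i(R\ast S) = \delta_i(R)\ast\delta_i(S)$ and $\delta_o(R\ast S) = \delta_o(R)\ast\delta_o(S)$.
   Context: Multirelations are subsets of $X\times\mathcal{P} Y$; $R$ is outer total if every $a\in X$ is related to some set. Relational composition $TV = \{(a,c)\mid\exists b.\ (a,b)\in T\wedge(b,c)\in V\}$. $\alpha(R) = \{(a,b)\mid\exists B.\ (a,B)\in R\wedge b\in B\}$; $\Lambda(T) = \{(a,T(a))\mid a\in X\}$ with $T(a) = \{b\mid(a,b)\in T\}$; $\eta(T) = \{(a,\{b\})\mid(a,b)\in T\}$; $\delta_o = \Lambda\circ\alpha$, $\delta_i = \eta\circ\alpha$. Peleg composition: $R \ast S = \{(a,C) \mid \exists B.\ (a,B) \in R \wedge \exists f : Y \to \mathcal{P} Z.\ (\forall b \in B.\ (b,f(b)) \in S) \wedge C = \bigcup_{b \in B} f(b)\}$. -}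

module Defs where

open import Data.Bool using (Bool; true)
open import Data.Product using (Σ; _×_; _,_; ∃)
open import Relation.Binary.PropositionalEquality using (_≡_)

-- Power set: subsets of Y as characteristic functions (classical power set,
-- the statement assumes excluded middle).
𝒫 : Set → Set
𝒫 Y = Y → Bool

_∈ₛ_ : {Y : Set} → Y → 𝒫 Y → Set
b ∈ₛ B = B b ≡ true

_≐ₛ_ : {Y : Set} → 𝒫 Y → 𝒫 Y → Set
_≐ₛ_ {Y} B C = (y : Y) → (y ∈ₛ B → y ∈ₛ C) × (y ∈ₛ C → y ∈ₛ B)

Rel : Set → Set → Set₁
Rel X Y = X → Y → Set

MRel : Set → Set → Set₁
MRel X Y = Rel X (𝒫 Y)

_≐_ : {X Y : Set} → Rel X Y → Rel X Y → Set
_≐_ {X} {Y} T V = (a : X) (b : Y) → (T a b → V a b) × (V a b → T a b)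

OuterTotal : {X Y : Set} → MRel X Y → Set
OuterTotal {X} {Y} R = (a : X) → Σ (𝒫 Y) (λ B → R a B)

_⨾_ : {X Y Z : Set} → Rel X Y → Rel Y Z → Rel X Z
_⨾_ {X} {Y} {Z} T V a c = Σ Y (λ b → T a b × V b c)

α : {X Y : Set} → MRel X Y → Rel X Y
α {X} {Y} R a b = Σ (𝒫 Y) (λ B → R a B × b ∈ₛ B)

Λ : {X Y : Set} → Rel X Y → MRel X Y
Λ {X} {Y} T a C = (b : Y) → (b ∈ₛ C → T a b) × (T a b → b ∈ₛ C)

η : {X Y : Set} → Rel X Y → MRel X Y
η {X} {Y} T a C = Σ Y (λ b → T a b × ((y : Y) → (y ∈ₛ C → y ≡ b) × (y ≡ b → y ∈ₛ C)))

δₒ : {X Y : Set} → MRel X Y → MRel X Y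
δₒ R = Λ (α R)

δᵢ : {X Y : Set} → MRel X Y → MRel X Y
δᵢ R = η (α R)

_∗_ : {X Y Z : Set} → MRel X Y → MRel Y Z → MRel X Z
_∗_ {X} {Y} {Z} R S a C =
  Σ (𝒫 Y) (λ B → R a B ×
    Σ (Y → 𝒫 Z) (λ f →
      ((b : Y) → b ∈ₛ B → S b (f b)) ×
      ((c : Z) → (c ∈ₛ C → ∃ (λ b → b ∈ₛ B × c ∈ₛ f b))
               × (∃ (λ b → b ∈ₛ B × c ∈ₛ f b) → c ∈ₛ C))))

{-# OPTIONS --safe #-}
-- The inclusion α(R ∗ S) ⊆ α(R) α(S) is read off a witness of R ∗ S.  For the
-- converse, a single S-image D of b has to be extended to a choice of S-images
-- over all of B; outer totality of S supplies the other images, and excluded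
-- middle decides where to put D.  Both η and
-- Λ turn relational composition into Peleg composition, so the statements about
-- δᵢ = η ∘ α and δₒ = Λ ∘ α follow from the one about α.
module Submission where

open import Defs
open import Level using (0ℓ)
open import Axiom.ExcludedMiddle using (ExcludedMiddle)
open import Data.Bool using (true; false)
open import Data.Empty using (⊥-elim)
open import Data.Product using (Σ; ∃; _×_; _,_; proj₁; proj₂)
open import Relation.Nullary using (yes; no)
open import Relation.Binary.PropositionalEquality using (_≡_; refl; sym; subst)

≐-trans : {X Y : Set} {T U V : Rel X Y} → T ≐ U → U ≐ V → T ≐ V
≐-trans T≐U U≐V a b =
  (λ t → proj₁ (U≐V a b) (proj₁ (T≐U a b) t)) ,
  (λ v → proj₂ (T≐U a b) (proj₂ (U≐V a b) v))

η-resp-≐ : {X Y : Set} {T V : Rel X Y} → T ≐ V → η T ≐ η V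
η-resp-≐ T≐V a C =
  (λ { (b , t , sing) → b , proj₁ (T≐V a b) t , sing }) ,
  (λ { (b , v , sing) → b , proj₂ (T≐V a b) v , sing })

Λ-resp-≐ : {X Y : Set} {T V : Rel X Y} → T ≐ V → Λ T ≐ Λ V
Λ-resp-≐ T≐V a C =
  (λ ΛT b → (λ b∈C → proj₁ (T≐V a b) (proj₁ (ΛT b) b∈C)) ,
            (λ v → proj₂ (ΛT b) (proj₂ (T≐V a b) v))) ,
  (λ ΛV b → (λ b∈C → proj₂ (T≐V a b) (proj₁ (ΛV b) b∈C)) ,
            (λ t → proj₂ (ΛV b) (proj₁ (T≐V a b) t)))

α-∗-⊆ : {X Y Z : Set} (R : MRel X Y) (S : MRel Y Z) →
        ∀ a c → α (R ∗ S) a c → (α R ⨾ α S) a c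
α-∗-⊆ R S a c (C , (B , RaB , f , fS , C≐⋃) , c∈C) with proj₁ (C≐⋃ c) c∈C
... | b , b∈B , c∈fb = b , (B , RaB , b∈B) , (f b , fS b b∈B , c∈fb)

module _ (em : ExcludedMiddle 0ℓ) where

  ⟪_⟫ : {Y : Set} → (Y → Set) → 𝒫 Y
  ⟪ P ⟫ y with em {P y}
  ... | yes _ = true
  ... | no _ = false

  ∈-⟪⟫⁻ : {Y : Set} {P : Y → Set} {y : Y} → y ∈ₛ ⟪ P ⟫ → P y
  ∈-⟪⟫⁻ {P = P} {y} y∈P with em {P y}
  ... | yes p = p

  ∈-⟪⟫⁺ : {Y : Set} {P : Y → Set} {y : Y} → P y → y ∈ₛ ⟪ P ⟫
  ∈-⟪⟫⁺ {P = P} {y} p with em {P y}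
  ... | yes _ = refl
  ... | no ¬p = ⊥-elim (¬p p)

  ⋃ : {Y Z : Set} → 𝒫 Y → (Y → 𝒫 Z) → 𝒫 Z
  ⋃ B f = ⟪ (λ c → ∃ λ b → b ∈ₛ B × c ∈ₛ f b) ⟫

  ∗-intro : {X Y Z : Set} {R : MRel X Y} {S : MRel Y Z} {a : X} {B : 𝒫 Y}
            {f : Y → 𝒫 Z} → R a B → ((b : Y) → b ∈ₛ B → S b (f b)) →
            (R ∗ S) a (⋃ B f)
  ∗-intro {B = B} {f} RaB fS = B , RaB , f , fS , λ c → ∈-⟪⟫⁻ , ∈-⟪⟫⁺

  choice-through : {Y Z : Set} {S : MRel Y Z} → OuterTotal S →
                   ∀ {b D} → S b D →
                   Σ (Y → 𝒫 Z) λ g → ((b′ : Y) → S b′ (g b′)) × g b ≡ D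
  choice-through {Y} {Z} {S} totS {b} {D} SbD = g , gS , gb≡D
    where
    g : Y → 𝒫 Z
    g b′ with em {b′ ≡ b}
    ... | yes _ = D
    ... | no _ = proj₁ (totS b′)
    gS : (b′ : Y) → S b′ (g b′)
    gS b′ with em {b′ ≡ b}
    ... | yes refl = SbD
    ... | no _ = proj₂ (totS b′)
    gb≡D : g b ≡ D
    gb≡D with em {b ≡ b}
    ... | yes _ = refl
    ... | no b≢b = ⊥-elim (b≢b refl)

  α-∗-⊇ : {X Y Z : Set} (R : MRel X Y) (S : MRel Y Z) → OuterTotal S →
          ∀ a c → (α R ⨾ α S) a c → α (R ∗ S) a c
  α-∗-⊇ R S totS a c (b , (B , RaB , b∈B) , (D , SbD , c∈D)) =
    let (g , gS , gb≡D) = choice-through totS SbD in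
    ⋃ B g , ∗-intro {R = R} {S} RaB (λ b′ _ → gS b′) ,
    ∈-⟪⟫⁺ (b , b∈B , subst (c ∈ₛ_) (sym gb≡D) c∈D)

  α-∗ : {X Y Z : Set} (R : MRel X Y) (S : MRel Y Z) → OuterTotal S →
        α (R ∗ S) ≐ (α R ⨾ α S)
  α-∗ R S totS a c = α-∗-⊆ R S a c , α-∗-⊇ R S totS a c

  η-⨾-∗ : {X Y Z : Set} (T : Rel X Y) (V : Rel Y Z) → η (T ⨾ V) ≐ (η T ∗ η V)
  η-⨾-∗ {Y = Y} {Z} T V a C = to , from
    where
    to : η (T ⨾ V) a C → (η T ∗ η V) a C
    to (c , (b , Tab , Vbc) , C≐｛c｝) =
      ⟪ _≡ b ⟫ , (b , Tab , λ y → ∈-⟪⟫⁻ , ∈-⟪⟫⁺) , (λ _ → C) , fV ,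
      λ c′ → (λ c′∈C → b , ∈-⟪⟫⁺ refl , c′∈C) , (λ { (_ , _ , c′∈C) → c′∈C })
      where
      fV : (b′ : Y) → b′ ∈ₛ ⟪ _≡ b ⟫ → η V b′ C
      fV b′ b′∈｛b｝ with ∈-⟪⟫⁻ b′∈｛b｝
      ... | refl = c , Vbc , C≐｛c｝
    from : (η T ∗ η V) a C → η (T ⨾ V) a C
    from (B , (b , Tab , B≐｛b｝) , f , fV , C≐⋃)
      with fV b (proj₂ (B≐｛b｝ b) refl)
    ... | c , Vbc , fb≐｛c｝ =
      c , (b , Tab , Vbc) ,
      λ y → (λ y∈C → only-c y (proj₁ (C≐⋃ y) y∈C)) ,
            (λ { refl → proj₂ (C≐⋃ c) (b , proj₂ (B≐｛b｝ b) refl , proj₂ (fb≐｛c｝ c) refl) })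
      where
      only-c : (y : Z) → ∃ (λ b′ → b′ ∈ₛ B × y ∈ₛ f b′) → y ≡ c
      only-c y (b′ , b′∈B , y∈fb′) with proj₁ (B≐｛b｝ b′) b′∈B
      ... | refl = proj₁ (fb≐｛c｝ y) y∈fb′

  Λ-⨾-∗ : {X Y Z : Set} (T : Rel X Y) (V : Rel Y Z) → Λ (T ⨾ V) ≐ (Λ T ∗ Λ V)
  Λ-⨾-∗ T V a C = to , from
    where
    to : Λ (T ⨾ V) a C → (Λ T ∗ Λ V) a C
    to C≐TV =
      ⟪ T a ⟫ , (λ b → ∈-⟪⟫⁻ , ∈-⟪⟫⁺) , (λ b → ⟪ V b ⟫) , (λ b _ c → ∈-⟪⟫⁻ , ∈-⟪⟫⁺) ,
      λ c → (λ c∈C → let (b , Tab , Vbc) = proj₁ (C≐TV c) c∈C in b , ∈-⟪⟫⁺ Tab , ∈-⟪⟫⁺ Vbc) ,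
            (λ { (b , b∈Ta , c∈Vb) → proj₂ (C≐TV c) (b , ∈-⟪⟫⁻ b∈Ta , ∈-⟪⟫⁻ c∈Vb) })
    from : (Λ T ∗ Λ V) a C → Λ (T ⨾ V) a C
    from (B , B≐Ta , f , fV , C≐⋃) c =
      (λ c∈C → let (b , b∈B , c∈fb) = proj₁ (C≐⋃ c) c∈C in
               b , proj₁ (B≐Ta b) b∈B , proj₁ (fV b b∈B c) c∈fb) ,
      (λ { (b , Tab , Vbc) → let b∈B = proj₂ (B≐Ta b) Tab in
                             proj₂ (C≐⋃ c) (b , b∈B , proj₂ (fV b b∈B c) Vbc) })

lemma5p5 : ExcludedMiddle 0ℓ →
    {X Y Z : Set} (R : MRel X Y) (S : MRel Y Z) →
    OuterTotal R → OuterTotal S →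
    (α (R ∗ S) ≐ (α R ⨾ α S))
    × (δᵢ (R ∗ S) ≐ (δᵢ R ∗ δᵢ S))
    × (δₒ (R ∗ S) ≐ (δₒ R ∗ δₒ S))
lemma5p5 em R S _ totS =
  α-∗ em R S totS ,
  ≐-trans (η-resp-≐ (α-∗ em R S totS)) (η-⨾-∗ em (α R) (α S)) ,
  ≐-trans (Λ-resp-≐ (α-∗ em R S totS)) (Λ-⨾-∗ em (α R) (α S))
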